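{- For every complexity measure $\psi$ and every table $T\in\mathcal{M}_k^2$ with at least two rows, there exists a table $T^*\in[T]$ such that $\psi^d(T^*)=W_\psi(T^*)=S_\psi(T^*)=S_\psi(T)$ and $\psi^s(T^*)\le V_\psi(T)$.
   Context: Fix an integer $k\ge 2$; $E_k=\{0,\ldots,k-1\}$, $E_2=\{0,1\}$, $\omega=\{0,1,2,\ldots\}$, $P=\{f_i:i\in\omega\}$ a set of attribute names. $\mathcal{M}_k^2$ is the set of rectangular tables filled with numbers from $E_k$, columns labeled with pairwise different attributes from $P$, rows pairwise different, each row labeled with a decision from $E_2$; the table without rows is denoted $\Lambda$. $P(T)$ is the set of column attributes. $\mathcal{M}_k^2\mathcal{C}$ is the set of tables in which all rows have the same decision ($\Lambda$ included). $T(f_{i_1},\delta_1)\cdots(f_{i_m},\delta_m)$ is the table of rows of $T$ having values $\delta_1,\ldots,\delta_m$ in the columns labeled $f_{i_1},\ldots,f_{i_m}$. Operations: for $D\subseteq P(T)$, $I(D,T)$ deletes the columns labeled by $D$ and, in each group of rows coinciding on the remaining columns, keeps one row with the minimum decision; $I(P(T),T)=\Lambda$. For $\nu:E_k^{|P(T)|}\to E_2$, $J(\nu,T)$ replaces the decision of each row $\bar\delta$ by $\nu(\bar\delta)$. $[T]=\{J(\nu,I(D,T)):D\subseteq P(T),\nu:E_k^{|P(T)\setminus D|}\to E_2\}$. A $k$-decision tree: finite directed rooted tree with at least two nodes, root and its leaving edges unlabeled, terminal nodes labeled with decisions from $E_2$, other nodes labeled with attributes from $P$ whose leaving edges are labeled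 with numbers from $E_k$; $P(\Gamma)$ is the set of attributes labeling nodes. For a complete path $\tau=v_1,d_1,\ldots,v_m,d_m,v_{m+1}$ (root to terminal node), $F(\tau)$ is the empty word if $m=1$, else $f_{i_2}\cdots f_{i_m}$ where $v_j$ is labeled $f_{i_j}$; $T(\tau)=T$ if $m=1$, else $T(f_{i_2},\delta_2)\cdots(f_{i_m},\delta_m)$ with $d_j$ labeled $\delta_j$. For $T\ne\Lambda$, a deterministic decision tree for $T$: exactly one edge leaves the root, edges leaving any other nonterminal node have pairwise different labels, $P(\Gamma)\subseteq P(T)$, every row of $T$ lies in some $T(\tau)$, and for every complete path either $T(\tau)=\Lambda$ or all rows of $T(\tau)$ have the terminal node's decision. For $T\notin\mathcal{M}_k^2\mathcal{C}$, a strongly nondeterministic decision tree for $T$: all terminal nodes labeled $1$, $P(\Gamma)\subseteq P(T)$, every row with decision $1$ lies in some $T(\tau)$, and for every complete path either $T(\tau)=\Lambda$ or all rows of $T(\tau)$ have decision $1$. Let $B$ be the set of finite words over $P$ (with empty word $\lambda$). A complexity measure is $\psi:B\to\omega$ with $\psi(\alpha)=0$ iff $\alpha=\lambda$, invariant under permutation of letters, $\psi(\alpha_1)\le\psi(\alpha_1\alpha_2)\le\psi(\alpha_1)+\psi(\alpha_2)$. For finite $D\subseteq P$: $\psi(\emptyset)=0$, $\psi(\{f_{i_1},\ldots,f_{i_m}\})=\psi(f_{i_1}\cdots f_{i_m})$. $\psi(\Gamma)=\max_\tau\psi(F(\tau))$ over complete paths. Parameters ($0$ on $\Lambda$); for $T\ne\Lambda$: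 $\psi^d(T)$ is the minimum of $\psi(\Gamma)$ over deterministic decision trees for $T$; $\psi^s(T)=0$ if $T\in\mathcal{M}_k^2\mathcal{C}$ and otherwise the minimum of $\psi(\Gamma)$ over strongly nondeterministic decision trees; $W_\psi(T)=\psi(P(T))$; $V_\psi(T)=\max\{\psi(f_i):f_i\in P(T)\}$; for a row $\bar\delta$, $S_\psi(T,\bar\delta)$ is the minimum of $\psi(D)$ over $D\subseteq P(T)$ such that on the columns labeled by $D$ the row $\bar\delta$ differs from all other rows of $T$, and $S_\psi(T)=\max_{\bar\delta}S_\psi(T,\bar\delta)$. -}

module Defs where

open import Data.Nat using (ℕ; zero; suc; _+_; _≤_; _⊓_; _⊔_; _≡ᵇ_)
open import Data.Fin using (Fin; zero; suc)
open import Data.Fin.Properties using () renaming (_≟_ to _≟F_)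
open import Data.Bool using (Bool; true; false; if_then_else_; _∧_; _∨_; not)
open import Data.Maybe using (Maybe; just; nothing)
open import Data.List using (List; []; _∷_; map; foldr; concatMap; _++_; [_]; length)
open import Data.List.NonEmpty using (List⁺; _∷_; toList)
open import Data.Vec as Vec using (Vec; []; _∷_)
open import Data.Vec.Properties using (≡-dec)
open import Data.Product using (Σ; ∃; _×_; _,_; proj₁; proj₂)
open import Data.Sum using (_⊎_)
open import Data.List.Relation.Unary.All using (All)
open import Data.List.Relation.Unary.Any using (Any)
open import Data.List.Relation.Unary.Unique.Propositional using (Unique)
open import Data.List.Membership.Propositional using (_∈_)
open import Data.List.Relation.Binary.Permutation.Propositional using (_↭_)
open import Relation.Binary.PropositionalEquality using (_≡_; _≢_)
open import Relation.Nullary using (¬_; yes; no)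
open import Relation.Nullary.Decidable using (⌊_⌋)
open import Function.Bundles using (_⇔_)

-- Attributes f_i are represented by their index i : ℕ.
-- E_k = Fin k, E_2 = Fin 2 (decisions).

E₂ : Set
E₂ = Fin 2

one : E₂
one = suc zero

record ComplexityMeasure : Set where
  field
    ψ        : List ℕ → ℕ
    zero-iff : ∀ α → (ψ α ≡ 0) ⇔ (α ≡ [])
    perm-inv : ∀ {α β} → α ↭ β → ψ α ≡ ψ β
    mono     : ∀ α₁ α₂ → ψ α₁ ≤ ψ (α₁ ++ α₂)
    subadd   : ∀ α₁ α₂ → ψ (α₁ ++ α₂) ≤ ψ α₁ + ψ α₂

record Table (k : ℕ) : Set where
  constructor table
  field
    n    : ℕ
    cols : Vec ℕ n
    rows : List (Vec (Fin k) n × E₂)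

open Table public

-- T ∈ M_k^2 : column attributes pairwise different, rows pairwise different.
record IsTable {k : ℕ} (T : Table k) : Set where
  field
    colsUnique : Unique (Vec.toList (cols T))
    rowsUnique : Unique (map proj₁ (rows T))

IsΛ : ∀ {k} → Table k → Set
IsΛ T = rows T ≡ []

InC : ∀ {k} → Table k → Set
InC T = All (λ r → All (λ r' → proj₂ r ≡ proj₂ r') (rows T)) (rows T)

-- Operation I(D,T).  D ⊆ P(T) is given as a Boolean vector over the
-- columns (true = the column is in D, i.e. is deleted).

rem : ∀ {n} → Vec Bool n → ℕ
rem []          = 0
rem (true ∷ D)  = rem D
rem (false ∷ D) = suc (rem D)

restrict : ∀ {A : Set} {n} (D : Vec Bool n) → Vec A n → Vec A (rem D)
restrict []          []       = []
restrict (true ∷ D)  (x ∷ xs) = restrict D xs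
restrict (false ∷ D) (x ∷ xs) = x ∷ restrict D xs

min₂ : E₂ → E₂ → E₂
min₂ zero    _       = zero
min₂ (suc _) zero    = zero
min₂ (suc a) (suc b) = suc a

insertMin : ∀ {k m} → Vec (Fin k) m × E₂ → List (Vec (Fin k) m × E₂)
          → List (Vec (Fin k) m × E₂)
insertMin (r , d) [] = [ (r , d) ]
insertMin (r , d) ((r' , d') ∷ rs) with ≡-dec _≟F_ r r'
... | yes _ = (r' , min₂ d d') ∷ rs
... | no  _ = (r' , d') ∷ insertMin (r , d) rs

-- if no column remains, the result is Λ
emptyIfZero : ∀ {A : Set} → ℕ → List A → List A
emptyIfZero zero    _  = []
emptyIfZero (suc _) xs = xs

I : ∀ {k} (T : Table k) → Vec Bool (n T) → Table k
I (table n cols rows) D =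
  table (rem D) (restrict D cols)
    (emptyIfZero (rem D)
      (foldr insertMin [] (map (λ rd → restrict D (proj₁ rd) , proj₂ rd) rows)))

J : ∀ {k} (T : Table k) → (Vec (Fin k) (n T) → E₂) → Table k
J (table n cols rows) ν = table n cols (map (λ rd → proj₁ rd , ν (proj₁ rd)) rows)

_∈[_] : ∀ {k} → Table k → Table k → Set
_∈[_] {k} T* T =
  Σ (Vec Bool (n T)) λ D → Σ (Vec (Fin k) (n (I T D)) → E₂) λ ν → T* ≡ J (I T D) ν

-- A tree is the
-- nonempty list of nodes the (unlabelled) root points to.

data Node (k : ℕ) : Set where
  leaf : E₂ → Node k
  node : ℕ → List⁺ (Fin k × Node k) → Node k

Tree : ℕ → Set
Tree k = List⁺ (Node k)

-- a complete path: the list of (attribute, edge label) pairs of its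
-- nonterminal non-root nodes, and the decision at its terminal node
Path : ℕ → Set
Path k = List (ℕ × Fin k) × E₂

mutual
  pathsN : ∀ {k} → Node k → List (Path k)
  pathsN (leaf d)    = [ ([] , d) ]
  pathsN (node f es) = pathsNE f es

  pathsNE : ∀ {k} → ℕ → List⁺ (Fin k × Node k) → List (Path k)
  pathsNE f (e ∷ es) = pathsE f e ++ pathsEs f es

  pathsEs : ∀ {k} → ℕ → List (Fin k × Node k) → List (Path k)
  pathsEs f []       = []
  pathsEs f (e ∷ es) = pathsE f e ++ pathsEs f es

  pathsE : ∀ {k} → ℕ → Fin k × Node k → List (Path k)
  pathsE f (δ , v) = map (λ p → ((f , δ) ∷ proj₁ p) , proj₂ p) (pathsN v)

paths : ∀ {k} → Tree k → List (Path k)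
paths Γ = concatMap pathsN (toList Γ)

F : ∀ {k} → Path k → List ℕ
F τ = map proj₁ (proj₁ τ)

ψΓ : ∀ {k} → ComplexityMeasure → Tree k → ℕ
ψΓ ψ Γ = foldr _⊔_ 0 (map (λ τ → ComplexityMeasure.ψ ψ (F τ)) (paths Γ))

data AttrsIn {k : ℕ} (cs : List ℕ) : Node k → Set where
  leaf : ∀ {d} → AttrsIn cs (leaf d)
  node : ∀ {f es} → f ∈ cs → All (λ e → AttrsIn cs (proj₂ e)) (toList es)
       → AttrsIn cs (node f es)

data DistinctLabels {k : ℕ} : Node k → Set where
  leaf : ∀ {d} → DistinctLabels (leaf d)
  node : ∀ {f es} → Unique (map proj₁ (toList es))
       → All (λ e → DistinctLabels (proj₂ e)) (toList es)
       → DistinctLabels (node f es)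

data TerminalsOne {k : ℕ} : Node k → Set where
  leaf : TerminalsOne (leaf one)
  node : ∀ {f es} → All (λ e → TerminalsOne (proj₂ e)) (toList es)
       → TerminalsOne (node f es)

valueAt : ∀ {k m} → Vec ℕ m → Vec (Fin k) m → ℕ → Maybe (Fin k)
valueAt []       []       f = nothing
valueAt (c ∷ cs) (x ∷ xs) f = if c ≡ᵇ f then just x else valueAt cs xs f

InPath : ∀ {k} (T : Table k) → Vec (Fin k) (n T) → Path k → Set
InPath T r τ = All (λ fδ → valueAt (cols T) r (proj₁ fδ) ≡ just (proj₂ fδ)) (proj₁ τ)

record IsDeterministic {k} (T : Table k) (Γ : Tree k) : Set where
  field
    rootOneEdge : List⁺.tail Γ ≡ []
    distinct    : All DistinctLabels (toList Γ)
    attrs       : All (AttrsIn (Vec.toList (cols T))) (toList Γ)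
    cover       : All (λ r → Any (InPath T (proj₁ r)) (paths Γ)) (rows T)
    correct     : All (λ τ → All (λ r → InPath T (proj₁ r) τ → proj₂ r ≡ proj₂ τ)
                                 (rows T)) (paths Γ)

record IsStronglyNondet {k} (T : Table k) (Γ : Tree k) : Set where
  field
    terminals : All TerminalsOne (toList Γ)
    attrs     : All (AttrsIn (Vec.toList (cols T))) (toList Γ)
    cover     : All (λ r → proj₂ r ≡ one → Any (InPath T (proj₁ r)) (paths Γ)) (rows T)
    correct   : All (λ τ → All (λ r → InPath T (proj₁ r) τ → proj₂ r ≡ one)
                               (rows T)) (paths Γ)

IsMinψ : ∀ {k} → ComplexityMeasure → (Tree k → Set) → ℕ → Set
IsMinψ ψ P m = (∃ λ Γ → P Γ × ψΓ ψ Γ ≡ m) × (∀ Γ → P Γ → m ≤ ψΓ ψ Γ)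

ψᵈ≡ : ∀ {k} → ComplexityMeasure → Table k → ℕ → Set
ψᵈ≡ ψ T m = (IsΛ T × m ≡ 0) ⊎ (¬ IsΛ T × IsMinψ ψ (IsDeterministic T) m)

ψˢ≡ : ∀ {k} → ComplexityMeasure → Table k → ℕ → Set
ψˢ≡ ψ T m = (IsΛ T × m ≡ 0) ⊎ (¬ IsΛ T × InC T × m ≡ 0)
          ⊎ (¬ IsΛ T × ¬ InC T × IsMinψ ψ (IsStronglyNondet T) m)

ifNonΛ : ∀ {A : Set} → List A → ℕ → ℕ
ifNonΛ []      _ = 0
ifNonΛ (_ ∷ _) x = x

W : ∀ {k} → ComplexityMeasure → Table k → ℕ
W ψ T = ifNonΛ (rows T) (ComplexityMeasure.ψ ψ (Vec.toList (cols T)))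

V : ∀ {k} → ComplexityMeasure → Table k → ℕ
V ψ T = ifNonΛ (rows T)
          (foldr _⊔_ 0 (map (λ f → ComplexityMeasure.ψ ψ [ f ]) (Vec.toList (cols T))))

allSubsets : (m : ℕ) → List (Vec Bool m)
allSubsets zero    = [ [] ]
allSubsets (suc m) = map (true ∷_) (allSubsets m) ++ map (false ∷_) (allSubsets m)

select : ∀ {A : Set} {m} → Vec Bool m → Vec A m → List A
select []          []       = []
select (true ∷ D)  (x ∷ xs) = x ∷ select D xs
select (false ∷ D) (x ∷ xs) = select D xs

differsOn : ∀ {k m} → Vec Bool m → Vec (Fin k) m → Vec (Fin k) m → Bool
differsOn []          []       []       = false
differsOn (true ∷ D)  (x ∷ xs) (y ∷ ys) = not ⌊ x ≟F y ⌋ ∨ differsOn D xs ys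
differsOn (false ∷ D) (x ∷ xs) (y ∷ ys) = differsOn D xs ys

separates : ∀ {k} (T : Table k) → Vec Bool (n T) → Vec (Fin k) (n T) → Bool
separates T D r =
  foldr _∧_ true (map (λ r' → ⌊ ≡-dec _≟F_ r (proj₁ r') ⌋ ∨ differsOn D r (proj₁ r')) (rows T))

-- S_ψ(T, r): minimum of ψ(D) over separating D ⊆ P(T).  (D = P(T) always
-- separates in a table of M_k^2, so starting the fold at ψ(P(T)) is harmless.)
Sᵣ : ∀ {k} → ComplexityMeasure → (T : Table k) → Vec (Fin k) (n T) → ℕ
Sᵣ ψ T r = foldr (λ D acc → if separates T D r
                              then ComplexityMeasure.ψ ψ (select D (cols T)) ⊓ acc
                              else acc)
                 (ComplexityMeasure.ψ ψ (Vec.toList (cols T)))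
                 (allSubsets (n T))

S : ∀ {k} → ComplexityMeasure → Table k → ℕ
S ψ T = foldr _⊔_ 0 (map (λ r → Sᵣ ψ T (proj₁ r)) (rows T))

-- Choose a row δ of T with S(T, δ) = S(T) and a cheapest set D of columns separating δ from the
-- other rows; T* keeps only the columns of D and gives decision 0 to δ alone. A set separating δ in
-- T* separates it in T too, so D stays cheapest and S(T*) = ψ(D) = W(T*). The path of δ in a
-- deterministic tree must isolate δ, so its columns separate δ and ψᵈ(T*) ≥ S(T*); querying every
-- column of D attains W(T*). A strongly nondeterministic tree must, on a path covering a row y ≠ δ,
-- query a column where y and δ differ; so the tree asking, for each such y, one cheapest column
-- where y differs from δ is optimal, and each of its paths costs at most V(T).

module Submission where

open import Defs
open import Data.Bool using (Bool; true; false; T; not; _∨_; if_then_else_)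
open import Data.Bool.Properties using (T?)
open import Data.Empty using (⊥-elim)
open import Data.Fin using (Fin; zero; suc)
open import Data.Fin.Properties using (0≢1+n) renaming (_≟_ to _≟F_)
open import Data.List using (List; []; _∷_; _++_; [_]; map; foldr; length; tabulate; allFin; filter; mapMaybe)
open import Data.List.Extrema.Nat using (argmin; argmin-sel; f[argmin]≤f[⊤]; f[argmin]≤f[xs])
open import Data.List.Membership.Propositional using (_∈_; find; lose)
open import Data.List.Membership.Propositional.Properties
  using (∈-map⁺; ∈-map⁻; ∈-++⁺ˡ; ∈-++⁺ʳ; ∈-++⁻; ∈-∃++; ∈-allFin; ∈-concatMap⁺; ∈-concatMap⁻; ∈-filter⁺; ∈-filter⁻)
open import Data.List.NonEmpty using (List⁺; _∷_; toList)
import Data.List.NonEmpty as List⁺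
open import Data.List.Relation.Binary.Permutation.Propositional using (_↭_; prep; ↭-refl; ↭-trans; ↭-sym)
open import Data.List.Relation.Binary.Permutation.Propositional.Properties using (∈-resp-↭; shift)
open import Data.List.Relation.Binary.Subset.Propositional using (_⊆_)
open import Data.List.Relation.Unary.All as All using (All; []; _∷_)
open import Data.List.Relation.Unary.All.Properties using (all⁺; all⁻; anti-mono; ¬All⇒Any¬)
open import Data.List.Relation.Unary.Any using (Any; here; there)
open import Data.List.Relation.Unary.Unique.Propositional using (Unique; []; _∷_)
open import Data.List.Relation.Unary.Unique.Propositional.Properties using (allFin⁺)
open import Data.Maybe using (Maybe; just; nothing)
open import Data.Maybe.Properties using (just-injective) renaming (≡-dec to ≡-decM)
open import Data.Nat using (ℕ; zero; suc; _≤_; _⊔_; _⊓_; _≡ᵇ_; z≤n; s≤s) renaming (_≟_ to _≟ℕ_)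
open import Data.List.Membership.DecPropositional _≟ℕ_ using (_∈?_)
open import Data.Nat.Properties
  using (≤-refl; ≤-trans; ≤-reflexive; ≤-antisym; ⊔-sel; ⊔-lub; ⊔-identityʳ; m≤m⊔n; m≤n⊔m;
         ⊓-sel; ⊓-glb; m⊓n≤m; m⊓n≤n; ≡ᵇ⇒≡; ≡⇒≡ᵇ; module ≤-Reasoning)
open import Data.Product using (∃; _×_; _,_; proj₁; proj₂)
open import Data.Sum using (_⊎_; inj₁; inj₂)
open import Data.Vec as Vec using (Vec; []; _∷_)
open import Data.Vec.Properties using (≡-dec)
open import Function using (_∘_)
open import Relation.Binary.PropositionalEquality using (_≡_; _≢_; refl; sym; trans; cong; subst)
open import Relation.Nullary using (¬_; Dec; yes; no; ¬?)
open import Relation.Nullary.Decidable using (⌊_⌋; decidable-stable)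

private
  variable
    A B : Set

⊔-fold-map-upper : ∀ (f : A → ℕ) {x xs} → x ∈ xs → f x ≤ foldr _⊔_ 0 (map f xs)
⊔-fold-map-upper f {xs = y ∷ ys} (here refl) = m≤m⊔n (f y) _
⊔-fold-map-upper f {xs = y ∷ ys} (there x∈ys) = ≤-trans (⊔-fold-map-upper f x∈ys) (m≤n⊔m (f y) _)

⊔-fold-map-least : ∀ (f : A → ℕ) {c} xs → (∀ {x} → x ∈ xs → f x ≤ c) → foldr _⊔_ 0 (map f xs) ≤ c
⊔-fold-map-least f []       _     = z≤n
⊔-fold-map-least f (x ∷ xs) bound = ⊔-lub (bound (here refl)) (⊔-fold-map-least f xs (bound ∘ there))

⊔-fold-map-mono-⊆ : ∀ (f : A → ℕ) {xs ys} → xs ⊆ ys → foldr _⊔_ 0 (map f xs) ≤ foldr _⊔_ 0 (map f ys)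
⊔-fold-map-mono-⊆ f {xs} xs⊆ys = ⊔-fold-map-least f xs (⊔-fold-map-upper f ∘ xs⊆ys)

⊔-fold-map-attained : ∀ (f : A → ℕ) x xs → ∃ λ y → y ∈ x ∷ xs × foldr _⊔_ 0 (map f (x ∷ xs)) ≡ f y
⊔-fold-map-attained f x []       = x , here refl , ⊔-identityʳ (f x)
⊔-fold-map-attained f x (y ∷ ys) with ⊔-fold-map-attained f y ys
... | z , z∈ , max≡fz with ⊔-sel (f x) (foldr _⊔_ 0 (map f (y ∷ ys)))
...   | inj₁ ≡fx = x , here refl , ≡fx
...   | inj₂ ≡max = z , there z∈ , trans ≡max max≡fz

module GuardedMinimum (p : A → Bool) (v : A → ℕ) where

  guardedMin : ℕ → List A → ℕ
  guardedMin s = foldr (λ D acc → if p D then v D ⊓ acc else acc) s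

  guardedMin-≤ : ∀ s {D} Ds → D ∈ Ds → T (p D) → guardedMin s Ds ≤ v D
  guardedMin-≤ s (D ∷ Ds) (here refl) pD with p D
  ... | true = m⊓n≤m _ _
  guardedMin-≤ s (E ∷ Ds) (there D∈) pD with p E
  ... | true  = ≤-trans (m⊓n≤n _ _) (guardedMin-≤ s Ds D∈ pD)
  ... | false = guardedMin-≤ s Ds D∈ pD

  guardedMin-≤-start : ∀ s Ds → guardedMin s Ds ≤ s
  guardedMin-≤-start s []       = ≤-refl
  guardedMin-≤-start s (E ∷ Ds) with p E
  ... | true  = ≤-trans (m⊓n≤n _ _) (guardedMin-≤-start s Ds)
  ... | false = guardedMin-≤-start s Ds

  guardedMin-greatest : ∀ {c} s Ds → c ≤ s → (∀ {D} → D ∈ Ds → T (p D) → c ≤ v D)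
                      → c ≤ guardedMin s Ds
  guardedMin-greatest s []       c≤s _     = c≤s
  guardedMin-greatest s (E ∷ Ds) c≤s bound with p E in pE
  ... | true  = ⊓-glb (bound (here refl) (subst T (sym pE) _))
                      (guardedMin-greatest s Ds c≤s (bound ∘ there))
  ... | false = guardedMin-greatest s Ds c≤s (bound ∘ there)

  guardedMin-attained : ∀ s Ds → guardedMin s Ds ≡ s ⊎ ∃ λ D → D ∈ Ds × T (p D) × guardedMin s Ds ≡ v D
  guardedMin-attained s []       = inj₁ refl
  guardedMin-attained s (E ∷ Ds) with p E in pE
  ... | false with guardedMin-attained s Ds
  ...   | inj₁ ≡s               = inj₁ ≡s
  ...   | inj₂ (D , D∈ , pD , ≡v) = inj₂ (D , there D∈ , pD , ≡v)
  guardedMin-attained s (E ∷ Ds) | true with ⊓-sel (v E) (guardedMin s Ds)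
  ... | inj₁ ≡vE = inj₂ (E , here refl , subst T (sym pE) _ , ≡vE)
  ... | inj₂ ≡rest with guardedMin-attained s Ds
  ...   | inj₁ ≡s               = inj₁ (trans ≡rest ≡s)
  ...   | inj₂ (D , D∈ , pD , ≡v) = inj₂ (D , there D∈ , pD , trans ≡rest ≡v)

cheapest : (A → ℕ) → List A → Maybe A
cheapest c []       = nothing
cheapest c (x ∷ xs) = just (argmin c x xs)

cheapest-∈ : ∀ (c : A → ℕ) xs {q} → cheapest c xs ≡ just q → q ∈ xs
cheapest-∈ c (x ∷ xs) refl with argmin-sel c x xs
... | inj₁ ≡x = here ≡x
... | inj₂ ∈xs = there ∈xs

cheapest-≤ : ∀ (c : A → ℕ) xs {q x} → cheapest c xs ≡ just q → x ∈ xs → c q ≤ c x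
cheapest-≤ c (y ∷ ys) refl (here refl) = f[argmin]≤f[⊤] {f = c} y ys
cheapest-≤ c (y ∷ ys) refl (there x∈) = All.lookup (f[argmin]≤f[xs] {f = c} y ys) x∈

cheapest-nonempty : ∀ (c : A → ℕ) {x xs} → x ∈ xs → ∃ λ q → cheapest c xs ≡ just q
cheapest-nonempty c {xs = y ∷ ys} _ = argmin c y ys , refl

∈-mapMaybe⁺ : ∀ (f : A → Maybe B) {x y xs} → x ∈ xs → f x ≡ just y → y ∈ mapMaybe f xs
∈-mapMaybe⁺ f {xs = x ∷ xs} (here refl) fx≡ rewrite fx≡ = here refl
∈-mapMaybe⁺ f {xs = z ∷ xs} (there x∈) fx≡ with f z
... | just _  = there (∈-mapMaybe⁺ f x∈ fx≡)
... | nothing = ∈-mapMaybe⁺ f x∈ fx≡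

∈-mapMaybe⁻ : ∀ (f : A → Maybe B) {y} xs → y ∈ mapMaybe f xs → ∃ λ x → x ∈ xs × f x ≡ just y
∈-mapMaybe⁻ f (x ∷ xs) y∈ with f x in fx≡
... | nothing = let z , z∈ , fz≡ = ∈-mapMaybe⁻ f xs y∈ in z , there z∈ , fz≡
... | just _ with y∈
...   | here refl = x , here refl , fx≡
...   | there y∈′ = let z , z∈ , fz≡ = ∈-mapMaybe⁻ f xs y∈′ in z , there z∈ , fz≡

unique-⊆⇒↭-++ : ∀ {α : List A} β → Unique α → α ⊆ β → ∃ λ γ → β ↭ α ++ γ
unique-⊆⇒↭-++ {α = []}    β _ _ = β , ↭-refl
unique-⊆⇒↭-++ {α = a ∷ α} β (a∉α ∷ uα) a∷α⊆β with ∈-∃++ (a∷α⊆β (here refl))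
... | ys , zs , refl =
  let γ , ys++zs↭ = unique-⊆⇒↭-++ (ys ++ zs) uα α⊆ys++zs
  in γ , ↭-trans (shift a ys zs) (prep a ys++zs↭)
  where
  α⊆ys++zs : α ⊆ ys ++ zs
  α⊆ys++zs b∈α with ∈-resp-↭ (shift a ys zs) (a∷α⊆β (there b∈α))
  ... | here refl = ⊥-elim (All.lookup a∉α b∈α refl)
  ... | there b∈  = b∈

module _ (Ψ : ComplexityMeasure) where
  open ComplexityMeasure Ψ

  ψ-mono-⊆ : ∀ {α} β → Unique α → α ⊆ β → ψ α ≤ ψ β
  ψ-mono-⊆ β uα α⊆β =
    let γ , β↭ = unique-⊆⇒↭-++ β uα α⊆β
    in ≤-trans (mono _ γ) (≤-reflexive (perm-inv (↭-sym β↭)))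

  ψ-[]-≤ : ∀ {f} β → f ∈ β → ψ [ f ] ≤ ψ β
  ψ-[]-≤ β f∈β = ψ-mono-⊆ β ([] ∷ []) λ { (here refl) → f∈β }

assignment : ∀ {k m} → Vec ℕ m → Vec (Fin k) m → List (ℕ × Fin k)
assignment []       []       = []
assignment (c ∷ cs) (x ∷ xs) = (c , x) ∷ assignment cs xs

map-proj₁-assignment : ∀ {k m} (cs : Vec ℕ m) (x : Vec (Fin k) m)
                     → map proj₁ (assignment cs x) ≡ Vec.toList cs
map-proj₁-assignment []       []       = refl
map-proj₁-assignment (c ∷ cs) (x ∷ xs) = cong (c ∷_) (map-proj₁-assignment cs xs)

∈-assignment⇒∈cols : ∀ {k m} (cs : Vec ℕ m) (x : Vec (Fin k) m) {f a}
                   → (f , a) ∈ assignment cs x → f ∈ Vec.toList cs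
∈-assignment⇒∈cols []       []       ()
∈-assignment⇒∈cols (c ∷ cs) (x ∷ xs) (here refl) = here refl
∈-assignment⇒∈cols (c ∷ cs) (x ∷ xs) (there fa∈) = there (∈-assignment⇒∈cols cs xs fa∈)

valueAt-∷ : ∀ {k m} c (cs : Vec ℕ m) (x : Fin k) xs f
          → (c ≡ f × valueAt (c ∷ cs) (x ∷ xs) f ≡ just x)
          ⊎ (c ≢ f × valueAt (c ∷ cs) (x ∷ xs) f ≡ valueAt cs xs f)
valueAt-∷ c cs x xs f with c ≡ᵇ f in c≡ᵇf
... | true  = inj₁ (≡ᵇ⇒≡ c f (subst T (sym c≡ᵇf) _) , refl)
... | false = inj₂ ((λ c≡f → subst T c≡ᵇf (≡⇒≡ᵇ c f c≡f)) , refl)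

∈-assignment⇒valueAt : ∀ {k m} (cs : Vec ℕ m) (x : Vec (Fin k) m) → Unique (Vec.toList cs)
                     → ∀ {f a} → (f , a) ∈ assignment cs x → valueAt cs x f ≡ just a
∈-assignment⇒valueAt []       []       _ ()
∈-assignment⇒valueAt (c ∷ cs) (x ∷ xs) _ {f} (here refl) with valueAt-∷ c cs x xs f
... | inj₁ (_ , at) = at
... | inj₂ (c≢c , _) = ⊥-elim (c≢c refl)
∈-assignment⇒valueAt (c ∷ cs) (x ∷ xs) (c∉cs ∷ ucs) {f} (there fa∈) with valueAt-∷ c cs x xs f
... | inj₁ (refl , _) = ⊥-elim (All.lookup c∉cs (∈-assignment⇒∈cols cs xs fa∈) refl)
... | inj₂ (_ , at)   = trans at (∈-assignment⇒valueAt cs xs ucs fa∈)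

valueAt⇒∈-assignment : ∀ {k m} (cs : Vec ℕ m) (x : Vec (Fin k) m) {f a}
                     → valueAt cs x f ≡ just a → (f , a) ∈ assignment cs x
valueAt⇒∈-assignment []       []       ()
valueAt⇒∈-assignment (c ∷ cs) (x ∷ xs) {f} at with valueAt-∷ c cs x xs f
... | inj₁ (refl , at′) rewrite just-injective (trans (sym at′) at) = here refl
... | inj₂ (_ , at′)    = there (valueAt⇒∈-assignment cs xs (trans (sym at′) at))

valueAt-assignment⇒≡ : ∀ {k m} (cs : Vec ℕ m) (x y : Vec (Fin k) m) → Unique (Vec.toList cs)
                     → All (λ p → valueAt cs x (proj₁ p) ≡ just (proj₂ p)) (assignment cs y) → x ≡ y
valueAt-assignment⇒≡ []       []       []       _             []           = refl
valueAt-assignment⇒≡ (c ∷ cs) (x ∷ xs) (y ∷ ys) (c∉cs ∷ ucs) (at-c ∷ ats) with valueAt-∷ c cs x xs c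
... | inj₂ (c≢c , _)   = ⊥-elim (c≢c refl)
... | inj₁ (_ , at-c′) with just-injective (trans (sym at-c′) at-c)
...   | refl = cong (x ∷_) (valueAt-assignment⇒≡ cs xs ys ucs (All.tabulate drop-c))
  where
  drop-c : ∀ {p} → p ∈ assignment cs ys → valueAt cs xs (proj₁ p) ≡ just (proj₂ p)
  drop-c {f , a} p∈ with valueAt-∷ c cs x xs f
  ... | inj₁ (refl , _) = ⊥-elim (All.lookup c∉cs (∈-assignment⇒∈cols cs ys p∈) refl)
  ... | inj₂ (_ , at)   = trans (sym at) (All.lookup ats p∈)

everywhere : ∀ {m} → Vec Bool m
everywhere = Vec.replicate _ true

-- I deletes the columns marked true, so I U (complement D) keeps exactly the columns of D.
complement : ∀ {m} → Vec Bool m → Vec Bool m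
complement = Vec.map not

membersOf : ∀ {m} → List ℕ → Vec ℕ m → Vec Bool m
membersOf α []       = []
membersOf α (c ∷ cs) = ⌊ c ∈? α ⌋ ∷ membersOf α cs

lift : ∀ {m} (D : Vec Bool m) → Vec Bool (rem (complement D)) → Vec Bool m
lift []          []       = []
lift (true ∷ D)  (b ∷ D*) = b ∷ lift D D*
lift (false ∷ D) D*       = false ∷ lift D D*

select-⊆ : ∀ {m} (D : Vec Bool m) (v : Vec A m) → select D v ⊆ Vec.toList v
select-⊆ []          []      ()
select-⊆ (true ∷ D)  (x ∷ v) (here refl) = here refl
select-⊆ (true ∷ D)  (x ∷ v) (there a∈)  = there (select-⊆ D v a∈)
select-⊆ (false ∷ D) (x ∷ v) a∈          = there (select-⊆ D v a∈)

select-unique : ∀ {m} (D : Vec Bool m) (v : Vec A m) → Unique (Vec.toList v) → Unique (select D v)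
select-unique []          []      []           = []
select-unique (true ∷ D)  (x ∷ v) (x∉v ∷ uv) = anti-mono (select-⊆ D v) x∉v ∷ select-unique D v uv
select-unique (false ∷ D) (x ∷ v) (_ ∷ uv)   = select-unique D v uv

select-everywhere : ∀ {m} (v : Vec A m) → select everywhere v ≡ Vec.toList v
select-everywhere []      = refl
select-everywhere (x ∷ v) = cong (x ∷_) (select-everywhere v)

toList-restrict-complement : ∀ {m} (D : Vec Bool m) (v : Vec A m)
                           → Vec.toList (restrict (complement D) v) ≡ select D v
toList-restrict-complement []          []      = refl
toList-restrict-complement (true ∷ D)  (x ∷ v) = cong (x ∷_) (toList-restrict-complement D v)
toList-restrict-complement (false ∷ D) (x ∷ v) = toList-restrict-complement D v

select-lift : ∀ {m} (D : Vec Bool m) D* (v : Vec A m)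
            → select (lift D D*) v ≡ select D* (restrict (complement D) v)
select-lift []          []           []      = refl
select-lift (true ∷ D)  (true ∷ D*)  (x ∷ v) = cong (x ∷_) (select-lift D D* v)
select-lift (true ∷ D)  (false ∷ D*) (x ∷ v) = select-lift D D* v
select-lift (false ∷ D) D*           (x ∷ v) = select-lift D D* v

select-membersOf-⊆ : ∀ {m} α (cs : Vec ℕ m) → select (membersOf α cs) cs ⊆ α
select-membersOf-⊆ α (c ∷ cs) f∈ with c ∈? α
select-membersOf-⊆ α (c ∷ cs) (here refl) | yes c∈α = c∈α
select-membersOf-⊆ α (c ∷ cs) (there f∈)  | yes _   = select-membersOf-⊆ α cs f∈
select-membersOf-⊆ α (c ∷ cs) f∈          | no _    = select-membersOf-⊆ α cs f∈

module _ {k : ℕ} where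

  differsOn-lift : ∀ {m} (D : Vec Bool m) D* (x y : Vec (Fin k) m)
                 → differsOn (lift D D*) x y
                 ≡ differsOn D* (restrict (complement D) x) (restrict (complement D) y)
  differsOn-lift []          []           []      []      = refl
  differsOn-lift (true ∷ D)  (true ∷ D*)  (a ∷ x) (b ∷ y) = cong (not ⌊ a ≟F b ⌋ ∨_) (differsOn-lift D D* x y)
  differsOn-lift (true ∷ D)  (false ∷ D*) (a ∷ x) (b ∷ y) = differsOn-lift D D* x y
  differsOn-lift (false ∷ D) D*           (a ∷ x) (b ∷ y) = differsOn-lift D D* x y

  differsOn-everywhere : ∀ {m} (x y : Vec (Fin k) m) → x ≢ y → T (differsOn everywhere x y)
  differsOn-everywhere []      []      x≢y = x≢y refl
  differsOn-everywhere (a ∷ x) (b ∷ y) x≢y with a ≟F b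
  ... | yes refl = differsOn-everywhere x y (x≢y ∘ cong (a ∷_))
  ... | no _     = _

  differsOn⇒restrict≢ : ∀ {m} (D : Vec Bool m) (x y : Vec (Fin k) m) → T (differsOn D x y)
                      → restrict (complement D) x ≢ restrict (complement D) y
  differsOn⇒restrict≢ []          []      []      ()
  differsOn⇒restrict≢ (true ∷ D)  (a ∷ x) (b ∷ y) diff eq with a ≟F b
  ... | yes _ = differsOn⇒restrict≢ D x y diff (cong Vec.tail eq)
  ... | no a≢b = a≢b (cong Vec.head eq)
  differsOn⇒restrict≢ (false ∷ D) (a ∷ x) (b ∷ y) diff eq = differsOn⇒restrict≢ D x y diff eq

  differsOn⇒rem≢0 : ∀ {m} (D : Vec Bool m) (x y : Vec (Fin k) m) → T (differsOn D x y) → rem (complement D) ≢ 0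
  differsOn⇒rem≢0 []          []      []      ()
  differsOn⇒rem≢0 (true ∷ D)  (a ∷ x) (b ∷ y) diff ()
  differsOn⇒rem≢0 (false ∷ D) (a ∷ x) (b ∷ y) diff = differsOn⇒rem≢0 D x y diff

  differsOn-there : ∀ {m} b (D : Vec Bool m) (a c : Fin k) x y
                  → T (differsOn D x y) → T (differsOn (b ∷ D) (a ∷ x) (c ∷ y))
  differsOn-there false D a c x y diff = diff
  differsOn-there true  D a c x y diff with a ≟F c
  ... | yes _ = diff
  ... | no _  = _

  valueAt-agree : ∀ {m} α (cs : Vec ℕ m) (x y : Vec (Fin k) m) → ¬ T (differsOn (membersOf α cs) x y)
                → ∀ {f} → f ∈ α → valueAt cs x f ≡ valueAt cs y f
  valueAt-agree α []       []      []      _      _   = refl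
  valueAt-agree α (c ∷ cs) (a ∷ x) (b ∷ y) agree {f} f∈α with valueAt-∷ c cs a x f | valueAt-∷ c cs b y f
  ... | inj₂ (_ , at-x) | inj₂ (_ , at-y) =
    let agree-rest = agree ∘ differsOn-there ⌊ c ∈? α ⌋ (membersOf α cs) a b x y
    in trans at-x (trans (valueAt-agree α cs x y agree-rest f∈α) (sym at-y))
  ... | inj₁ (c≡f , _) | inj₂ (c≢f , _) = ⊥-elim (c≢f c≡f)
  ... | inj₂ (c≢f , _) | inj₁ (c≡f , _) = ⊥-elim (c≢f c≡f)
  ... | inj₁ (refl , at-x) | inj₁ (_ , at-y) with c ∈? α
  ...   | no c∉α = ⊥-elim (c∉α f∈α)
  ...   | yes _ with a ≟F b
  ...     | yes refl = trans at-x (sym at-y)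
  ...     | no _     = ⊥-elim (agree _)

module _ {k : ℕ} (U : Table k) where

  separates⁺ : ∀ D r → (∀ {r′} → r′ ∈ rows U → r ≢ proj₁ r′ → T (differsOn D r (proj₁ r′)))
             → T (separates U D r)
  separates⁺ D r diff = all⁻ _ (All.tabulate λ {r′} r′∈ → separated (proj₁ r′) (diff r′∈))
    where
    separated : ∀ x → (r ≢ x → T (differsOn D r x)) → T (⌊ ≡-dec _≟F_ r x ⌋ ∨ differsOn D r x)
    separated x d with ≡-dec _≟F_ r x
    ... | yes _   = _
    ... | no r≢x = d r≢x

  separates⁻ : ∀ D {r r′} → T (separates U D r) → r′ ∈ rows U → r ≢ proj₁ r′ → T (differsOn D r (proj₁ r′))
  separates⁻ D {r} {r′} sep r′∈ r≢r′ = separated (All.lookup (all⁺ _ (rows U) sep) r′∈)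
    where
    separated : T (⌊ ≡-dec _≟F_ r (proj₁ r′) ⌋ ∨ differsOn D r (proj₁ r′)) → T (differsOn D r (proj₁ r′))
    separated s with ≡-dec _≟F_ r (proj₁ r′)
    ... | yes r≡r′ = ⊥-elim (r≢r′ r≡r′)
    ... | no _     = s

  separates-everywhere : ∀ r → T (separates U everywhere r)
  separates-everywhere r = separates⁺ everywhere r λ {r′} _ → differsOn-everywhere r (proj₁ r′)

keys : ∀ {k} (U : Table k) → List (Vec (Fin k) (n U))
keys U = map proj₁ (rows U)

module _ {k m : ℕ} where

  insertMin-new : ∀ (p : Vec (Fin k) m × E₂) rs → proj₁ p ∈ map proj₁ (insertMin p rs)
  insertMin-new (r , d) []               = here refl
  insertMin-new (r , d) ((r′ , d′) ∷ rs) with ≡-dec _≟F_ r r′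
  ... | yes r≡r′ = here r≡r′
  ... | no _     = there (insertMin-new (r , d) rs)

  insertMin-old : ∀ (p : Vec (Fin k) m × E₂) rs {x} → x ∈ map proj₁ rs → x ∈ map proj₁ (insertMin p rs)
  insertMin-old (r , d) ((r′ , d′) ∷ rs) x∈ with ≡-dec _≟F_ r r′ | x∈
  ... | yes _ | here x≡r′ = here x≡r′
  ... | yes _ | there x∈′ = there x∈′
  ... | no _  | here x≡r′ = here x≡r′
  ... | no _  | there x∈′ = there (insertMin-old (r , d) rs x∈′)

  foldr-insertMin-keys : ∀ (ps : List (Vec (Fin k) m × E₂)) {x}
                       → x ∈ map proj₁ ps → x ∈ map proj₁ (foldr insertMin [] ps)
  foldr-insertMin-keys (p ∷ ps) (here refl) = insertMin-new p (foldr insertMin [] ps)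
  foldr-insertMin-keys (p ∷ ps) (there x∈)  = insertMin-old p (foldr insertMin [] ps) (foldr-insertMin-keys ps x∈)

emptyIfZero-≢0 : ∀ m {xs : List A} → m ≢ 0 → emptyIfZero m xs ≡ xs
emptyIfZero-≢0 zero    m≢0 = ⊥-elim (m≢0 refl)
emptyIfZero-≢0 (suc m) _   = refl

I-keys : ∀ {k} (U : Table k) (D : Vec Bool (n U)) → rem D ≢ 0
       → ∀ {r} → r ∈ rows U → restrict D (proj₁ r) ∈ keys (I U D)
I-keys U D rem≢0 {r} r∈ =
  subst (λ rs → restrict D (proj₁ r) ∈ map proj₁ rs) (sym (emptyIfZero-≢0 (rem D) rem≢0))
        (foldr-insertMin-keys (map restrictRow (rows U)) (∈-map⁺ proj₁ (∈-map⁺ restrictRow r∈)))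
  where
  restrictRow : Vec (Fin _) (n U) × E₂ → Vec (Fin _) (rem D) × E₂
  restrictRow (x , d) = restrict D x , d

module _ {k : ℕ} (U : Table k) (g : Vec (Fin k) (n U) → E₂) where

  J-row⁺ : ∀ {x} → x ∈ keys U → (x , g x) ∈ rows (J U g)
  J-row⁺ x∈ with ∈-map⁻ proj₁ x∈
  ... | r , r∈ , refl = ∈-map⁺ _ r∈

  J-row⁻ : ∀ {r} → r ∈ rows (J U g) → ∃ λ x → x ∈ keys U × r ≡ (x , g x)
  J-row⁻ r∈ with ∈-map⁻ _ r∈
  ... | r , r∈′ , refl = proj₁ r , ∈-map⁺ proj₁ r∈′ , refl

  J-rows-All : ∀ {P : Vec (Fin k) (n U) × E₂ → Set} → (∀ {x} → x ∈ keys U → P (x , g x)) → All P (rows (J U g))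
  J-rows-All {P} Pkeys = All.tabulate λ r∈ → P-row (J-row⁻ r∈)
    where
    P-row : ∀ {r} → (∃ λ x → x ∈ keys U × r ≡ (x , g x)) → P r
    P-row (x , x∈ , refl) = Pkeys x∈

separates-lift : ∀ {k} (U : Table k) D {r} (g : Vec (Fin k) (rem (complement D)) → E₂) D*
               → rem (complement D) ≢ 0 → T (separates U D r)
               → T (separates (J (I U (complement D)) g) D* (restrict (complement D) r))
               → T (separates U (lift D D*) r)
separates-lift U D {r} g D* rem≢0 sepD sepD* = separates⁺ U (lift D D*) r λ {r′} r′∈ r≢r′ →
  let diff = separates⁻ U D sepD r′∈ r≢r′
  in subst T (sym (differsOn-lift D D* r (proj₁ r′)))
       (separates⁻ (J (I U (complement D)) g) D* sepD*
          (J-row⁺ (I U (complement D)) g (I-keys U (complement D) rem≢0 r′∈))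
          (differsOn⇒restrict≢ D r (proj₁ r′) diff))

maxCost : ComplexityMeasure → ∀ {m} → Vec ℕ m → ℕ
maxCost Ψ cs = foldr _⊔_ 0 (map (λ f → ComplexityMeasure.ψ Ψ [ f ]) (Vec.toList cs))

∈-allSubsets : ∀ {m} (D : Vec Bool m) → D ∈ allSubsets m
∈-allSubsets []          = here refl
∈-allSubsets (true ∷ D)  = ∈-++⁺ˡ (∈-map⁺ (true ∷_) (∈-allSubsets D))
∈-allSubsets {suc m} (false ∷ D) = ∈-++⁺ʳ (map (true ∷_) (allSubsets m)) (∈-map⁺ (false ∷_) (∈-allSubsets D))

module _ (Ψ : ComplexityMeasure) {k : ℕ} (U : Table k) where
  open ComplexityMeasure Ψ

  private
    ψcols = ψ (Vec.toList (cols U))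
    module Separating r = GuardedMinimum (λ D → separates U D r) (λ D → ψ (select D (cols U)))

  Sᵣ-≤ : ∀ D {r} → T (separates U D r) → Sᵣ Ψ U r ≤ ψ (select D (cols U))
  Sᵣ-≤ D {r} = Separating.guardedMin-≤ r ψcols (allSubsets (n U)) (∈-allSubsets D)

  Sᵣ-≤-ψcols : ∀ r → Sᵣ Ψ U r ≤ ψcols
  Sᵣ-≤-ψcols r = Separating.guardedMin-≤-start r ψcols (allSubsets (n U))

  Sᵣ-greatest : ∀ {c} r → c ≤ ψcols → (∀ D → T (separates U D r) → c ≤ ψ (select D (cols U))) → c ≤ Sᵣ Ψ U r
  Sᵣ-greatest r c≤ bound = Separating.guardedMin-greatest r ψcols (allSubsets (n U)) c≤ (λ {D} _ → bound D)

  Sᵣ-attained : ∀ r → ∃ λ D → T (separates U D r) × Sᵣ Ψ U r ≡ ψ (select D (cols U))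
  Sᵣ-attained r with Separating.guardedMin-attained r ψcols (allSubsets (n U))
  ... | inj₁ ≡ψcols =
    everywhere , separates-everywhere U r , trans ≡ψcols (cong ψ (sym (select-everywhere (cols U))))
  ... | inj₂ (D , _ , sep , ≡ψD) = D , sep , ≡ψD

  S≡ψcols : ∀ {r} → r ∈ rows U → Sᵣ Ψ U (proj₁ r) ≡ ψcols → S Ψ U ≡ ψcols
  S≡ψcols r∈ Sᵣ≡ = ≤-antisym
    (⊔-fold-map-least (λ r → Sᵣ Ψ U (proj₁ r)) (rows U) λ {r} _ → Sᵣ-≤-ψcols (proj₁ r))
    (subst (_≤ S Ψ U) Sᵣ≡ (⊔-fold-map-upper (λ r → Sᵣ Ψ U (proj₁ r)) r∈))

  W≡ψcols : ∀ {r} → r ∈ rows U → W Ψ U ≡ ψcols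
  W≡ψcols r∈ with rows U
  W≡ψcols () | []
  ... | _ ∷ _ = refl

-- Decision trees

module _ {k : ℕ} where

  ∈-pathsEs⁻ : ∀ f (es : List (Fin k × Node k)) {τ} → τ ∈ pathsEs f es → ∃ λ e → e ∈ es × τ ∈ pathsE f e
  ∈-pathsEs⁻ f (e ∷ es) τ∈ with ∈-++⁻ (pathsE f e) τ∈
  ... | inj₁ τ∈e  = e , here refl , τ∈e
  ... | inj₂ τ∈es = let e′ , e′∈ , τ∈e′ = ∈-pathsEs⁻ f es τ∈es in e′ , there e′∈ , τ∈e′

  ∈-pathsEs⁺ : ∀ f (es : List (Fin k × Node k)) {e τ} → e ∈ es → τ ∈ pathsE f e → τ ∈ pathsEs f es
  ∈-pathsEs⁺ f (e ∷ es) (here refl) τ∈ = ∈-++⁺ˡ τ∈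
  ∈-pathsEs⁺ f (e ∷ es) (there e∈)  τ∈ = ∈-++⁺ʳ (pathsE f e) (∈-pathsEs⁺ f es e∈ τ∈)

  ∈-paths⁻ : ∀ (Γ : Tree k) {τ} → τ ∈ paths Γ → ∃ λ N → N ∈ toList Γ × τ ∈ pathsN N
  ∈-paths⁻ Γ τ∈ = find (∈-concatMap⁻ pathsN τ∈)

  ∈-paths⁺ : ∀ (Γ : Tree k) {N τ} → N ∈ toList Γ → τ ∈ pathsN N → τ ∈ paths Γ
  ∈-paths⁺ Γ N∈ τ∈ = ∈-concatMap⁺ pathsN (lose N∈ τ∈)

  ∈-paths-root : ∀ (N : Node k) {τ} → τ ∈ paths (N ∷ []) → τ ∈ pathsN N
  ∈-paths-root N τ∈ with ∈-paths⁻ (N ∷ []) τ∈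
  ... | _ , here refl , τ∈N = τ∈N

  F-≤-ψΓ : ∀ Ψ (Γ : Tree k) {τ} → τ ∈ paths Γ → ComplexityMeasure.ψ Ψ (F τ) ≤ ψΓ Ψ Γ
  F-≤-ψΓ Ψ Γ = ⊔-fold-map-upper (λ τ → ComplexityMeasure.ψ Ψ (F τ))

  ψΓ-least : ∀ Ψ (Γ : Tree k) {c} → (∀ {τ} → τ ∈ paths Γ → ComplexityMeasure.ψ Ψ (F τ) ≤ c) → ψΓ Ψ Γ ≤ c
  ψΓ-least Ψ Γ = ⊔-fold-map-least (λ τ → ComplexityMeasure.ψ Ψ (F τ)) (paths Γ)

module _ {k′ : ℕ} where
  private K = suc k′

  mutual
    fullTree : ∀ {m} → Vec ℕ m → (Vec (Fin K) m → E₂) → Node K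
    fullTree []       g = leaf (g [])
    fullTree (c ∷ cs) g = node c (List⁺.map (fullBranch cs g) (zero ∷ tabulate suc))

    fullBranch : ∀ {m} → Vec ℕ m → (Vec (Fin K) (suc m) → E₂) → Fin K → Fin K × Node K
    fullBranch cs g a = a , fullTree cs (g ∘ (a ∷_))

  paths-fullTree⁻ : ∀ {m} (cs : Vec ℕ m) g {τ} → τ ∈ pathsN (fullTree cs g) → ∃ λ x → τ ≡ (assignment cs x , g x)
  paths-fullTree⁻ []       g (here refl) = [] , refl
  paths-fullTree⁻ (c ∷ cs) g τ∈ with ∈-pathsEs⁻ c (map (fullBranch cs g) (allFin K)) τ∈
  ... | e , e∈ , τ∈e with ∈-map⁻ (fullBranch cs g) e∈
  ...   | a , _ , refl with ∈-map⁻ _ τ∈e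
  ...     | σ , σ∈ , refl with paths-fullTree⁻ cs (g ∘ (a ∷_)) σ∈
  ...       | x , refl = a ∷ x , refl

  paths-fullTree⁺ : ∀ {m} (cs : Vec ℕ m) g x → (assignment cs x , g x) ∈ pathsN (fullTree cs g)
  paths-fullTree⁺ []       g []      = here refl
  paths-fullTree⁺ (c ∷ cs) g (a ∷ x) =
    ∈-pathsEs⁺ c (map (fullBranch cs g) (allFin K)) (∈-map⁺ (fullBranch cs g) (∈-allFin a))
      (∈-map⁺ _ (paths-fullTree⁺ cs (g ∘ (a ∷_)) x))

  fullTree-distinct : ∀ {m} (cs : Vec ℕ m) g → DistinctLabels (fullTree cs g)
  fullTree-distinct []       g = leaf
  fullTree-distinct (c ∷ cs) g =
    node (subst Unique (sym (map-proj₁-branches (allFin K))) (allFin⁺ K))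
         (All.tabulate λ e∈ → distinct-branch (∈-map⁻ (fullBranch cs g) e∈))
    where
    map-proj₁-branches : ∀ as → map proj₁ (map (fullBranch cs g) as) ≡ as
    map-proj₁-branches []       = refl
    map-proj₁-branches (a ∷ as) = cong (a ∷_) (map-proj₁-branches as)
    distinct-branch : ∀ {e} → (∃ λ a → a ∈ allFin K × e ≡ fullBranch cs g a) → DistinctLabels (proj₂ e)
    distinct-branch (a , _ , refl) = fullTree-distinct cs (g ∘ (a ∷_))

  fullTree-attrs : ∀ {m} (cs : Vec ℕ m) g {α} → Vec.toList cs ⊆ α → AttrsIn α (fullTree cs g)
  fullTree-attrs []       g _     = leaf
  fullTree-attrs (c ∷ cs) g cs⊆α =
    node (cs⊆α (here refl)) (All.tabulate λ e∈ → attrs-branch (∈-map⁻ (fullBranch cs g) e∈))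
    where
    attrs-branch : ∀ {e} → (∃ λ a → a ∈ allFin K × e ≡ fullBranch cs g a) → AttrsIn _ (proj₂ e)
    attrs-branch (a , _ , refl) = fullTree-attrs cs (g ∘ (a ∷_)) (cs⊆α ∘ there)

  module _ (U : Table K) (g : Vec (Fin K) (n U) → E₂) where

    fullTree-deterministic : Unique (Vec.toList (cols U)) → IsDeterministic (J U g) (fullTree (cols U) g ∷ [])
    fullTree-deterministic ucols = record
      { rootOneEdge = refl
      ; distinct    = fullTree-distinct (cols U) g ∷ []
      ; attrs       = fullTree-attrs (cols U) g (λ c∈ → c∈) ∷ []
      ; cover       = J-rows-All U g λ {x} _ →
                        lose (∈-paths⁺ (fullTree (cols U) g ∷ []) (here refl) (paths-fullTree⁺ (cols U) g x))
                             (All.tabulate (∈-assignment⇒valueAt (cols U) x ucols))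
      ; correct     = All.tabulate λ τ∈ →
                        correct-path (paths-fullTree⁻ (cols U) g (∈-paths-root (fullTree (cols U) g) τ∈))
      }
      where
      correct-path : ∀ {τ} → (∃ λ y → τ ≡ (assignment (cols U) y , g y))
                   → All (λ r → InPath (J U g) (proj₁ r) τ → proj₂ r ≡ proj₂ τ) (rows (J U g))
      correct-path (y , refl) = J-rows-All U g λ {x} _ x∈τ → cong g (valueAt-assignment⇒≡ (cols U) x y ucols x∈τ)

  ψΓ-fullTree : ∀ Ψ {m} (cs : Vec ℕ m) g → ψΓ Ψ (fullTree cs g ∷ []) ≡ ComplexityMeasure.ψ Ψ (Vec.toList cs)
  ψΓ-fullTree Ψ cs g = ≤-antisym
    (ψΓ-least Ψ Γ λ τ∈ → F-≤-ψcols (paths-fullTree⁻ cs g (∈-paths-root (fullTree cs g) τ∈)))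
    (subst (_≤ ψΓ Ψ Γ) (cong ψ (map-proj₁-assignment cs x₀))
       (F-≤-ψΓ Ψ Γ (∈-paths⁺ Γ (here refl) (paths-fullTree⁺ cs g x₀))))
    where
    open ComplexityMeasure Ψ
    Γ = fullTree cs g ∷ []
    x₀ = Vec.replicate _ zero
    F-≤-ψcols : ∀ {τ} → (∃ λ x → τ ≡ (assignment cs x , g x)) → ψ (F τ) ≤ ψ (Vec.toList cs)
    F-≤-ψcols (x , refl) = ≤-reflexive (cong ψ (map-proj₁-assignment cs x))

-- The path of a row whose decision no other row shares reads a set of columns separating it.
deterministic-≥-Sᵣ : ∀ Ψ {k} (U : Table k) {Γ r d} → Unique (Vec.toList (cols U)) → (r , d) ∈ rows U
                   → (∀ {r′} → r′ ∈ rows U → proj₂ r′ ≡ d → proj₁ r′ ≡ r)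
                   → IsDeterministic U Γ → Sᵣ Ψ U r ≤ ψΓ Ψ Γ
deterministic-≥-Sᵣ Ψ U {Γ} {r} {d} ucols r∈ alone det
  with τ , τ∈ , r∈τ ← find (All.lookup (IsDeterministic.cover det) r∈) = begin
    Sᵣ Ψ U r                     ≤⟨ Sᵣ-≤ Ψ U D separating ⟩
    ψ (select D (cols U))        ≤⟨ ψ-mono-⊆ Ψ (F τ) (select-unique D (cols U) ucols)
                                                       (select-membersOf-⊆ (F τ) (cols U)) ⟩
    ψ (F τ)                      ≤⟨ F-≤-ψΓ Ψ Γ τ∈ ⟩
    ψΓ Ψ Γ                       ∎
  where
  open ComplexityMeasure Ψ
  open ≤-Reasoning
  D = membersOf (F τ) (cols U)
  decided = All.lookup (IsDeterministic.correct det) τ∈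
  separating : T (separates U D r)
  separating = separates⁺ U D r λ {r′} r′∈ r≢r′ → decidable-stable (T? _) λ agree →
    let r′∈τ = All.tabulate λ fa∈ →
                 trans (sym (valueAt-agree (F τ) (cols U) r (proj₁ r′) agree (∈-map⁺ proj₁ fa∈)))
                       (All.lookup r∈τ fa∈)
    in r≢r′ (sym (alone r′∈ (trans (All.lookup decided r′∈ r′∈τ) (sym (All.lookup decided r∈ r∈τ)))))

twig : ∀ {k} → ℕ × Fin k → Node k
twig (f , a) = node f ((a , leaf one) ∷ [])

module _ {k : ℕ} (R : List⁺ (ℕ × Fin k)) where

  paths-twigs⁻ : ∀ {τ} → τ ∈ paths (List⁺.map twig R) → ∃ λ q → q ∈ toList R × τ ≡ (q ∷ [] , one)
  paths-twigs⁻ τ∈ with ∈-paths⁻ (List⁺.map twig R) τ∈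
  ... | N , N∈ , τ∈N with ∈-map⁻ twig N∈
  ...   | q , q∈ , refl with τ∈N
  ...     | here refl = q , q∈ , refl

  paths-twigs⁺ : ∀ {q} → q ∈ toList R → (q ∷ [] , one) ∈ paths (List⁺.map twig R)
  paths-twigs⁺ q∈ = ∈-paths⁺ (List⁺.map twig R) (∈-map⁺ twig q∈) (here refl)

-- Tables in which a single row has decision 0

indicator : ∀ {k m} → Vec (Fin k) m → Vec (Fin k) m → E₂
indicator δ x with ≡-dec _≟F_ x δ
... | yes _ = zero
... | no _  = one

module _ {k m : ℕ} {δ : Vec (Fin k) m} where

  indicator-self : indicator δ δ ≡ zero
  indicator-self with ≡-dec _≟F_ δ δ
  ... | yes _   = refl
  ... | no δ≢δ = ⊥-elim (δ≢δ refl)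

  indicator-other : ∀ {x} → x ≢ δ → indicator δ x ≡ one
  indicator-other {x} x≢δ with ≡-dec _≟F_ x δ
  ... | yes x≡δ = ⊥-elim (x≢δ x≡δ)
  ... | no _    = refl

  indicator-one⇒≢ : ∀ {x} → indicator δ x ≡ one → x ≢ δ
  indicator-one⇒≢ ind≡1 refl = 0≢1+n (trans (sym indicator-self) ind≡1)

  indicator-zero⇒≡ : ∀ {x} → indicator δ x ≡ zero → x ≡ δ
  indicator-zero⇒≡ {x} ind≡0 with ≡-dec _≟F_ x δ
  ... | yes x≡δ = x≡δ

module IndicatorTable (Ψ : ComplexityMeasure) {k′ : ℕ} (U : Table (suc k′)) (δ : Vec (Fin (suc k′)) (n U))
                      (ucols : Unique (Vec.toList (cols U))) (δ∈ : δ ∈ keys U) where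
  open ComplexityMeasure Ψ

  U* : Table (suc k′)
  U* = J U (indicator δ)

  row⁺ : ∀ {x} → x ∈ keys U → (x , indicator δ x) ∈ rows U*
  row⁺ = J-row⁺ U (indicator δ)

  δ-row : (δ , zero) ∈ rows U*
  δ-row = subst (λ d → (δ , d) ∈ rows U*) indicator-self (row⁺ δ∈)

  nonempty : ¬ IsΛ U*
  nonempty U*≡Λ with rows U* | δ-row
  nonempty refl | [] | ()

  ψᵈ-U* : Sᵣ Ψ U* δ ≡ ψ (Vec.toList (cols U)) → ψᵈ≡ Ψ U* (W Ψ U*)
  ψᵈ-U* Sᵣ≡ψcols = inj₂ (nonempty , (full , fullTree-deterministic U (indicator δ) ucols , full≡W) , W≤)
    where
    full = fullTree (cols U) (indicator δ) ∷ []
    W-U* : W Ψ U* ≡ ψ (Vec.toList (cols U))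
    W-U* = W≡ψcols Ψ U* δ-row
    full≡W = trans (ψΓ-fullTree Ψ (cols U) (indicator δ)) (sym W-U*)
    alone : ∀ {r′} → r′ ∈ rows U* → proj₂ r′ ≡ zero → proj₁ r′ ≡ δ
    alone r′∈ with J-row⁻ U (indicator δ) r′∈
    ... | x , _ , refl = indicator-zero⇒≡
    W≤ : ∀ Γ → IsDeterministic U* Γ → W Ψ U* ≤ ψΓ Ψ Γ
    W≤ Γ det = subst (_≤ ψΓ Ψ Γ) (trans Sᵣ≡ψcols (sym W-U*)) (deterministic-≥-Sᵣ Ψ U* ucols δ-row alone det)

  cost : ℕ × Fin (suc k′) → ℕ
  cost q = ψ [ proj₁ q ]

  At-δ : ℕ × Fin (suc k′) → Set
  At-δ q = valueAt (cols U) δ (proj₁ q) ≡ just (proj₂ q)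

  at-δ? : ∀ q → Dec (At-δ q)
  at-δ? q = ≡-decM _≟F_ (valueAt (cols U) δ (proj₁ q)) (just (proj₂ q))

  differences : Vec (Fin (suc k′)) (n U) → List (ℕ × Fin (suc k′))
  differences y = filter (¬? ∘ at-δ?) (assignment (cols U) y)

  ∈-differences⁺ : ∀ {y f a} → valueAt (cols U) y f ≡ just a → ¬ At-δ (f , a) → (f , a) ∈ differences y
  ∈-differences⁺ {y} at-y not-at-δ = ∈-filter⁺ (¬? ∘ at-δ?) (valueAt⇒∈-assignment (cols U) y at-y) not-at-δ

  ∈-differences⁻ : ∀ {y q} → q ∈ differences y → valueAt (cols U) y (proj₁ q) ≡ just (proj₂ q) × ¬ At-δ q
  ∈-differences⁻ {y} q∈ with ∈-filter⁻ (¬? ∘ at-δ?) {xs = assignment (cols U) y} q∈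
  ... | q∈y , not-at-δ = ∈-assignment⇒valueAt (cols U) y ucols q∈y , not-at-δ

  ∈-differences⇒≢δ : ∀ {y q} → q ∈ differences y → y ≢ δ
  ∈-differences⇒≢δ q∈ refl = let at-δ , not-at-δ = ∈-differences⁻ q∈ in not-at-δ at-δ

  differences-nonempty : ∀ {y} → y ≢ δ → ∃ λ q → q ∈ differences y
  differences-nonempty {y} y≢δ
    with q , q∈y , not-at-δ ← find (¬All⇒Any¬ at-δ? _ (y≢δ ∘ sym ∘ valueAt-assignment⇒≡ (cols U) δ y ucols))
    = q , ∈-filter⁺ (¬? ∘ at-δ?) q∈y not-at-δ

  path-difference : ∀ {y τ} → InPath U* y τ → ¬ InPath U* δ τ → ∃ λ q → q ∈ proj₁ τ × q ∈ differences y
  path-difference {y} {τ} y∈τ δ∉τ with q , q∈τ , not-at-δ ← find (¬All⇒Any¬ at-δ? (proj₁ τ) δ∉τ)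
    = q , q∈τ , ∈-differences⁺ (All.lookup y∈τ q∈τ) not-at-δ

  stronglyNondet-difference : ∀ {Γ y} → IsStronglyNondet U* Γ → y ∈ keys U → y ≢ δ
                            → ∃ λ τ → τ ∈ paths Γ × ∃ λ p → p ∈ proj₁ τ × p ∈ differences y
  stronglyNondet-difference sn y∈ y≢δ
    with τ , τ∈ , y∈τ ← find (All.lookup (IsStronglyNondet.cover sn) (row⁺ y∈) (indicator-other y≢δ))
    = τ , τ∈ , path-difference {τ = τ} y∈τ λ δ∈τ →
        0≢1+n (All.lookup (All.lookup (IsStronglyNondet.correct sn) τ∈) δ-row δ∈τ)

  cheapestDifference : Vec (Fin (suc k′)) (n U) → Maybe (ℕ × Fin (suc k′))
  cheapestDifference y = cheapest cost (differences y)

  module CheapestDifferences {x₀} (x₀∈ : x₀ ∈ keys U) (x₀≢δ : x₀ ≢ δ) where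

    first-root : ∃ λ q → cheapestDifference x₀ ≡ just q
    first-root = cheapest-nonempty cost (proj₂ (differences-nonempty x₀≢δ))

    roots : List⁺ (ℕ × Fin (suc k′))
    roots = proj₁ first-root ∷ mapMaybe cheapestDifference (keys U)

    Γs : Tree (suc k′)
    Γs = List⁺.map twig roots

    root-cheapest : ∀ {q} → q ∈ toList roots → ∃ λ y → y ∈ keys U × cheapestDifference y ≡ just q
    root-cheapest (here refl) = x₀ , x₀∈ , proj₂ first-root
    root-cheapest (there q∈)  = ∈-mapMaybe⁻ cheapestDifference (keys U) q∈

    root-difference : ∀ {q} → q ∈ toList roots → ∃ λ y → q ∈ differences y
    root-difference q∈ = let y , _ , cheap≡ = root-cheapest q∈ in y , cheapest-∈ cost (differences y) cheap≡

    root-∈cols : ∀ {q} → q ∈ toList roots → proj₁ q ∈ Vec.toList (cols U)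
    root-∈cols q∈ =
      let y , q∈y = root-difference q∈
      in ∈-assignment⇒∈cols (cols U) y (proj₁ (∈-filter⁻ (¬? ∘ at-δ?) {xs = assignment (cols U) y} q∈y))

    Γs-stronglyNondet : IsStronglyNondet U* Γs
    Γs-stronglyNondet = record
      { terminals = All.tabulate λ N∈ → terminal (∈-map⁻ twig N∈)
      ; attrs     = All.tabulate λ N∈ → attrs (∈-map⁻ twig N∈)
      ; cover     = J-rows-All U (indicator δ) cover
      ; correct   = All.tabulate λ τ∈ → correct (paths-twigs⁻ roots τ∈)
      }
      where
      terminal : ∀ {N} → (∃ λ q → q ∈ toList roots × N ≡ twig q) → TerminalsOne N
      terminal (q , _ , refl) = node (leaf ∷ [])
      attrs : ∀ {N} → (∃ λ q → q ∈ toList roots × N ≡ twig q) → AttrsIn (Vec.toList (cols U)) N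
      attrs (q , q∈ , refl) = node (root-∈cols q∈) (leaf ∷ [])
      cover : ∀ {y} → y ∈ keys U → indicator δ y ≡ one → Any (InPath U* y) (paths Γs)
      cover {y} y∈ ind≡1
        with q , cheap≡ ← cheapest-nonempty cost (proj₂ (differences-nonempty (indicator-one⇒≢ ind≡1)))
        = lose (paths-twigs⁺ roots (there (∈-mapMaybe⁺ cheapestDifference y∈ cheap≡)))
               (proj₁ (∈-differences⁻ (cheapest-∈ cost (differences y) cheap≡)) ∷ [])
      correct : ∀ {τ} → (∃ λ q → q ∈ toList roots × τ ≡ (q ∷ [] , one))
              → All (λ r → InPath U* (proj₁ r) τ → proj₂ r ≡ one) (rows U*)
      correct (q , q∈ , refl) = J-rows-All U (indicator δ) λ {z} _ z∈τ → indicator-other λ { refl →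
        proj₂ (∈-differences⁻ (proj₂ (root-difference q∈))) (All.head z∈τ) }

    Γs-optimal : ∀ Γ → IsStronglyNondet U* Γ → ψΓ Ψ Γs ≤ ψΓ Ψ Γ
    Γs-optimal Γ sn = ψΓ-least Ψ Γs λ τ∈ → root-bound (paths-twigs⁻ roots τ∈)
      where
      open ≤-Reasoning
      root-bound : ∀ {τ} → (∃ λ q → q ∈ toList roots × τ ≡ (q ∷ [] , one)) → ψ (F τ) ≤ ψΓ Ψ Γ
      root-bound (q , q∈ , refl)
        with y , y∈ , cheap≡ ← root-cheapest q∈
        with τ′ , τ′∈ , p , p∈τ′ , p∈y ← stronglyNondet-difference sn y∈
                                           (∈-differences⇒≢δ (cheapest-∈ cost (differences y) cheap≡))
        = begin
          cost q       ≤⟨ cheapest-≤ cost (differences y) cheap≡ p∈y ⟩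
          cost p       ≤⟨ ψ-[]-≤ Ψ (F τ′) (∈-map⁺ proj₁ p∈τ′) ⟩
          ψ (F τ′)     ≤⟨ F-≤-ψΓ Ψ Γ τ′∈ ⟩
          ψΓ Ψ Γ       ∎

    Γs-≤-maxCost : ψΓ Ψ Γs ≤ maxCost Ψ (cols U)
    Γs-≤-maxCost = ψΓ-least Ψ Γs λ τ∈ → root-bound (paths-twigs⁻ roots τ∈)
      where
      root-bound : ∀ {τ} → (∃ λ q → q ∈ toList roots × τ ≡ (q ∷ [] , one))
                 → ψ (F τ) ≤ maxCost Ψ (cols U)
      root-bound (q , q∈ , refl) = ⊔-fold-map-upper (λ f → ψ [ f ]) (root-∈cols q∈)

    not-constant : ¬ InC U*
    not-constant constant = 0≢1+n (trans (All.lookup (All.lookup constant δ-row) (row⁺ x₀∈)) (indicator-other x₀≢δ))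

    ψˢ-U* : ∃ λ s → ψˢ≡ Ψ U* s × s ≤ maxCost Ψ (cols U)
    ψˢ-U* = ψΓ Ψ Γs
          , inj₂ (inj₂ (nonempty , not-constant , (Γs , Γs-stronglyNondet , refl) , Γs-optimal))
          , Γs-≤-maxCost

-- Restriction to a cheapest separating set

Sᵣ-restriction : ∀ Ψ {k} (U : Table k) D {r} (g : Vec (Fin k) (rem (complement D)) → E₂)
               → rem (complement D) ≢ 0 → T (separates U D r)
               → Sᵣ Ψ U r ≡ ComplexityMeasure.ψ Ψ (select D (cols U))
               → Sᵣ Ψ (J (I U (complement D)) g) (restrict (complement D) r)
               ≡ ComplexityMeasure.ψ Ψ (Vec.toList (restrict (complement D) (cols U)))
Sᵣ-restriction Ψ U D {r} g rem≢0 sepD Sᵣ≡ψD = ≤-antisym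
  (Sᵣ-≤-ψcols Ψ U* (restrict (complement D) r))
  (Sᵣ-greatest Ψ U* (restrict (complement D) r) ≤-refl λ D* sepD* → begin
    ψ (Vec.toList (restrict (complement D) (cols U)))  ≡⟨ cong ψ (toList-restrict-complement D (cols U)) ⟩
    ψ (select D (cols U))                              ≡⟨ sym Sᵣ≡ψD ⟩
    Sᵣ Ψ U r                                           ≤⟨ Sᵣ-≤ Ψ U (lift D D*)
                                                              (separates-lift U D g D* rem≢0 sepD sepD*) ⟩
    ψ (select (lift D D*) (cols U))                    ≡⟨ cong ψ (select-lift D D* (cols U)) ⟩
    ψ (select D* (restrict (complement D) (cols U)))   ∎)
  where
  open ComplexityMeasure Ψ
  open ≤-Reasoning
  U* = J (I U (complement D)) g

another-row : ∀ {k m} (r₁ r₂ : Vec (Fin k) m × E₂) rs → Unique (map proj₁ (r₁ ∷ r₂ ∷ rs))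
            → ∀ x → ∃ λ r → r ∈ r₁ ∷ r₂ ∷ rs × x ≢ proj₁ r
another-row r₁ r₂ rs ((r₁≢r₂ ∷ _) ∷ _) x with ≡-dec _≟F_ x (proj₁ r₁)
... | yes refl  = r₂ , there (here refl) , r₁≢r₂
... | no x≢r₁ = r₁ , here refl , x≢r₁

module Restriction (Ψ : ComplexityMeasure) {k : ℕ} (U : Table (suc k)) (ucols : Unique (Vec.toList (cols U)))
                   {rδ r′} (rδ∈ : rδ ∈ rows U) (r′∈ : r′ ∈ rows U) (δ≢r′ : proj₁ rδ ≢ proj₁ r′)
                   (D : Vec Bool (n U)) (sepD : T (separates U D (proj₁ rδ)))
                   (Sᵣ≡ψD : Sᵣ Ψ U (proj₁ rδ) ≡ ComplexityMeasure.ψ Ψ (select D (cols U))) where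
  open ComplexityMeasure Ψ

  private
    δ = proj₁ rδ
    δ-differs-r′ = separates⁻ U D sepD r′∈ δ≢r′
    rem≢0 = differsOn⇒rem≢0 D δ (proj₁ r′) δ-differs-r′
    Uᴰ = I U (complement D)
    δ′ = restrict (complement D) δ
    cols-Uᴰ≡ = toList-restrict-complement D (cols U)
    ucols-Uᴰ : Unique (Vec.toList (cols Uᴰ))
    ucols-Uᴰ = subst Unique (sym cols-Uᴰ≡) (select-unique D (cols U) ucols)

  open IndicatorTable Ψ Uᴰ δ′ ucols-Uᴰ (I-keys U (complement D) rem≢0 rδ∈) public
  open CheapestDifferences (I-keys U (complement D) rem≢0 r′∈)
                           (differsOn⇒restrict≢ D δ (proj₁ r′) δ-differs-r′ ∘ sym)

  U*∈[U] : U* ∈[ U ]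
  U*∈[U] = complement D , indicator δ′ , refl

  Sᵣ-U* : Sᵣ Ψ U* δ′ ≡ ψ (Vec.toList (cols Uᴰ))
  Sᵣ-U* = Sᵣ-restriction Ψ U D (indicator δ′) rem≢0 sepD Sᵣ≡ψD

  ψᵈ-U*≡W : ψᵈ≡ Ψ U* (W Ψ U*)
  ψᵈ-U*≡W = ψᵈ-U* Sᵣ-U*

  W≡S : W Ψ U* ≡ S Ψ U*
  W≡S = trans (W≡ψcols Ψ U* δ-row) (sym (S≡ψcols Ψ U* δ-row Sᵣ-U*))

  S-U*≡Sᵣ : S Ψ U* ≡ Sᵣ Ψ U δ
  S-U*≡Sᵣ = trans (S≡ψcols Ψ U* δ-row Sᵣ-U*) (trans (cong ψ cols-Uᴰ≡) (sym Sᵣ≡ψD))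

  ψˢ-U*≤maxCost : ∃ λ s → ψˢ≡ Ψ U* s × s ≤ maxCost Ψ (cols U)
  ψˢ-U*≤maxCost = let s , ψˢ≡s , s≤ = ψˢ-U* in
    s , ψˢ≡s , ≤-trans s≤ (⊔-fold-map-mono-⊆ (λ f → ψ [ f ]) (select-⊆ D (cols U) ∘ subst (_ ∈_) cols-Uᴰ≡))

lemma12 : (k : ℕ) → 2 ≤ k → (ψ : ComplexityMeasure) → (T : Table k) → IsTable T
        → 2 ≤ length (rows T)
        → ∃ λ (T* : Table k) → T* ∈[ T ]
            × ψᵈ≡ ψ T* (W ψ T*)
            × W ψ T* ≡ S ψ T*
            × S ψ T* ≡ S ψ T
            × ∃ λ (s : ℕ) → ψˢ≡ ψ T* s × s ≤ V ψ T
lemma12 zero    ()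
lemma12 (suc k) _ ψ (table n cs [])           _   ()
lemma12 (suc k) _ ψ (table n cs (_ ∷ []))     _   (s≤s ())
lemma12 (suc k) _ ψ T@(table n cs (r₁ ∷ r₂ ∷ rs)) isT _
  with rδ , rδ∈ , S≡Sᵣ ← ⊔-fold-map-attained (λ r → Sᵣ ψ T (proj₁ r)) r₁ (r₂ ∷ rs)
  with D , sepD , Sᵣ≡ψD ← Sᵣ-attained ψ T (proj₁ rδ)
  with r′ , r′∈ , δ≢r′ ← another-row r₁ r₂ rs (IsTable.rowsUnique isT) (proj₁ rδ)
  = U* , U*∈[U] , ψᵈ-U*≡W , W≡S , trans S-U*≡Sᵣ (sym S≡Sᵣ) , ψˢ-U*≤maxCost
  where open Restriction ψ T (IsTable.colsUnique isT) rδ∈ r′∈ δ≢r′ D sepD Sᵣ≡ψD
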